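{- Let $A$ be an $r\times c$ mixed matrix with variable positions indexed by $E$, let $n=r+c$, and let $A'$ be an evaluation of $A$ in which the variable $x_i$ ($i\in E$) has value $a_i$. Suppose there is $a\in\{1,\dots,n^{10}\}$ with $\operatorname{rank} A'_{x_i\gets a}=\operatorname{rank} A'=k$, and there is $u\in D(A'_{x_i\gets a})\setminus D(A')$. Then for every $\tilde a\ne a_i$, $u\in D(A'_{x_i\gets\tilde a})$.
   Context: A mixed matrix is an $r\times c$ matrix each entry of which is either an element of $\mathbb{Q}$ or an indeterminate, distinct positions carrying distinct indeterminates; $E$ indexes the positions holding indeterminates, and $x_i$ is the indeterminate at position $i\in E$. An evaluation substitutes a rational value for each indeterminate; $A'_{x_i\gets a}$ is obtained from $A'$ by changing the value of $x_i$ to $a$. For a matrix $B$ with row index set $L_r$ and column index set $L_c$ (disjoint), $D(B)=\{i\in L_r\cup L_c:\operatorname{rank}(B\setminus\{i\})=\operatorname{rank} B\}$, where $B\setminus\{i\}$ deletes row $i$ (if $i\in L_r$) or column $i$ (if $i\in L_c$). -}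

module Defs where

open import Data.Nat using (ℕ; zero; suc)
open import Data.Fin using (Fin; zero; suc)
open import Data.Fin.Properties using () renaming (_≟_ to _≟ᶠ_)
open import Data.Integer using (+_)
open import Data.Rational using (ℚ; 0ℚ; _+_; _*_; _/_)
open import Data.Maybe using (Maybe; just; nothing)
open import Data.Product using (Σ; ∃; _×_; _,_)
open import Data.Sum using (_⊎_; inj₁; inj₂)
open import Relation.Binary.PropositionalEquality using (_≡_; _≢_)
open import Relation.Nullary using (¬_; yes; no)

Mat : Set → Set → Set
Mat R C = R → C → ℚ

∑ : (k : ℕ) → (Fin k → ℚ) → ℚ
∑ zero    f = 0ℚ
∑ (suc k) f = f zero + ∑ k (λ j → f (suc j))

IndepCols : {R C : Set} → Mat R C → {k : ℕ} → (Fin k → C) → Set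
IndepCols {R} M {k} f =
  (λc : Fin k → ℚ) → (∀ (x : R) → ∑ k (λ j → λc j * M x (f j)) ≡ 0ℚ) →
  ∀ j → λc j ≡ 0ℚ

HasRank : {R C : Set} → Mat R C → ℕ → Set
HasRank {R} {C} M k =
  (Σ (Fin k → C) (λ f → IndepCols M f)) ×
  ((f : Fin (suc k) → C) → ¬ IndepCols M f)

DelMat : {r c : ℕ} → (u : Fin r ⊎ Fin c) → Set
DelMat {r} {c} (inj₁ i) = Mat (Σ (Fin r) (λ j → j ≢ i)) (Fin c)
DelMat {r} {c} (inj₂ i) = Mat (Fin r) (Σ (Fin c) (λ j → j ≢ i))

delete : {r c : ℕ} → Mat (Fin r) (Fin c) → (u : Fin r ⊎ Fin c) → DelMat u
delete M (inj₁ i) (j , _) y = M j y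
delete M (inj₂ i) x (j , _) = M x j

rankDel : {r c : ℕ} (M : Mat (Fin r) (Fin c)) (u : Fin r ⊎ Fin c) → ℕ → Set
rankDel M (inj₁ i) k = HasRank (delete M (inj₁ i)) k
rankDel M (inj₂ i) k = HasRank (delete M (inj₂ i)) k

-- u ∈ D(M) : rank (M \ {u}) = rank M.
InD : {r c : ℕ} → (Fin r ⊎ Fin c) → Mat (Fin r) (Fin c) → Set
InD u M = ∃ λ k → HasRank M k × rankDel M u k

-- Mixed matrix: nothing = indeterminate at that position (indeterminate x_(p,q)
-- is identified with its position, so distinct positions carry distinct ones).
MixedMatrix : ℕ → ℕ → Set
MixedMatrix r c = Fin r → Fin c → Maybe ℚ

IsVar : {r c : ℕ} → MixedMatrix r c → Fin r × Fin c → Set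
IsVar A (p , q) = A p q ≡ nothing

eval : {r c : ℕ} → MixedMatrix r c → (Fin r → Fin c → ℚ) → Mat (Fin r) (Fin c)
eval A val p q with A p q
... | just v  = v
... | nothing = val p q

setVal : {r c : ℕ} → (Fin r → Fin c → ℚ) → Fin r × Fin c → ℚ → (Fin r → Fin c → ℚ)
setVal val (p , q) a p' q' with p' ≟ᶠ p | q' ≟ᶠ q
... | yes _ | yes _ = a
... | _     | _     = val p' q'

evalSet : {r c : ℕ} → MixedMatrix r c → (Fin r → Fin c → ℚ) → Fin r × Fin c → ℚ → Mat (Fin r) (Fin c)
evalSet A val i a = eval A (setVal val i a)

ℕtoℚ : ℕ → ℚ
ℕtoℚ n = (+ n) / 1

module Submission where

-- Changing the value of the variable at (p, q) moves the evaluation along a line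
-- t ↦ N t = N₀ + t ε ηᵀ of rank-one perturbations (ε, η the indicator vectors of p
-- and q), and every row or column deletion of it moves along such a line too. Along such a line,
-- columns that are dependent at two distinct points are dependent everywhere: a
-- dependence l at b turns at t into the column (t − b)(η·l) ε, so it persists if η·l = 0,
-- and otherwise two dependences at b ≠ b′ combine into one at t whose η-weight is
-- (b − b′)(η·l)(η·m) ≠ 0. Rank k at a and at a_i thus gives rank at most k everywhere,
-- and a basis of the deletion at a stays independent at every t ≠ a_i, since it is
-- dependent at a_i. So both the rank and the deletion rank are k at every t ≠ a_i.

open import Defs
open import Data.Nat using (ℕ; zero; suc; _≤_; _+_; _^_; _≤?_; z≤n; s≤s⁻¹)
import Data.Nat.Properties as ℕ
open import Data.Fin using (Fin; zero; suc)
open import Data.Fin.Properties using () renaming (_≟_ to _≟ᶠ_)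
open import Data.Rational using (ℚ; 0ℚ; 1ℚ; _*_; _-_; 1/_; ≢-nonZero)
  renaming (_+_ to _+ℚ_)
open import Data.Rational.Properties
  using (_≟_; +-0-group; +-identityˡ; +-identityʳ; *-identityˡ; *-identityʳ;
         *-zeroˡ; *-zeroʳ; *-assoc; *-inverseˡ)
open import Data.Rational.Solver using (module +-*-Solver)
open import Algebra.Properties.Group +-0-group using (x∙y⁻¹≈ε⇒x≈y)
open import Data.Vec.Functional using (_∷_)
open import Data.Maybe using (just; nothing)
open import Data.Product using (Σ; ∃; _×_; _,_; proj₁; proj₂)
open import Data.Sum using (_⊎_; inj₁; inj₂)
open import Data.Empty using (⊥-elim)
open import Function using (_∘_; id)
open import Relation.Nullary using (¬_; yes; no)
open import Relation.Nullary.Decidable using (decidable-stable)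
open import Relation.Binary.PropositionalEquality
  using (_≡_; _≢_; refl; sym; trans; cong; cong₂; subst; module ≡-Reasoning)

open +-*-Solver
open ≡-Reasoning

lincomb : ∀ {k} → (Fin k → ℚ) → (Fin k → ℚ) → ℚ
lincomb {k} l w = ∑ k (λ j → l j * w j)

lincomb-congʳ : ∀ {k} (l : Fin k → ℚ) {w w′ : Fin k → ℚ} →
                (∀ j → w j ≡ w′ j) → lincomb l w ≡ lincomb l w′
lincomb-congʳ {zero}  l w≡w′ = refl
lincomb-congʳ {suc k} l w≡w′ =
  cong₂ _+ℚ_ (cong (l zero *_) (w≡w′ zero)) (lincomb-congʳ (l ∘ suc) (w≡w′ ∘ suc))

lincomb-zeroˡ : ∀ {k} {l : Fin k → ℚ} (w : Fin k → ℚ) →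
                (∀ j → l j ≡ 0ℚ) → lincomb l w ≡ 0ℚ
lincomb-zeroˡ {zero}  w l≡0 = refl
lincomb-zeroˡ {suc k} {l} w l≡0 = begin
  l zero * w zero +ℚ lincomb (l ∘ suc) (w ∘ suc)
            ≡⟨ cong₂ _+ℚ_ (trans (cong (_* w zero) (l≡0 zero)) (*-zeroˡ (w zero)))
                          (lincomb-zeroˡ (w ∘ suc) (l≡0 ∘ suc)) ⟩
  0ℚ +ℚ 0ℚ  ≡⟨ +-identityˡ 0ℚ ⟩
  0ℚ        ∎

lincomb-linearˡ : ∀ {k} (α β : ℚ) (l m w : Fin k → ℚ) →
                  lincomb (λ j → α * l j +ℚ β * m j) w
                    ≡ α * lincomb l w +ℚ β * lincomb m w
lincomb-linearˡ {zero}  α β l m w =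
  solve 2 (λ α β → con 0ℚ := α :* con 0ℚ :+ β :* con 0ℚ) refl α β
lincomb-linearˡ {suc k} α β l m w = begin
  head +ℚ lincomb (λ j → α * l (suc j) +ℚ β * m (suc j)) (w ∘ suc)
    ≡⟨ cong (head +ℚ_) (lincomb-linearˡ α β (l ∘ suc) (m ∘ suc) (w ∘ suc)) ⟩
  head +ℚ (α * L +ℚ β * M)
    ≡⟨ solve 7 (λ α β l₀ m₀ w₀ L M →
         (α :* l₀ :+ β :* m₀) :* w₀ :+ (α :* L :+ β :* M)
           := α :* (l₀ :* w₀ :+ L) :+ β :* (m₀ :* w₀ :+ M))
         refl α β (l zero) (m zero) (w zero) L M ⟩
  α * (l zero * w zero +ℚ L) +ℚ β * (m zero * w zero +ℚ M)  ∎
  where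
  head = (α * l zero +ℚ β * m zero) * w zero
  L = lincomb (l ∘ suc) (w ∘ suc)
  M = lincomb (m ∘ suc) (w ∘ suc)

lincomb-affineʳ : ∀ {k} (l d h : Fin k → ℚ) (s : ℚ) →
                  lincomb l (λ j → d j +ℚ s * h j) ≡ lincomb l d +ℚ s * lincomb l h
lincomb-affineʳ {zero}  l d h s = solve 1 (λ s → con 0ℚ := con 0ℚ :+ s :* con 0ℚ) refl s
lincomb-affineʳ {suc k} l d h s = begin
  head +ℚ lincomb (l ∘ suc) (λ j → d (suc j) +ℚ s * h (suc j))
    ≡⟨ cong (head +ℚ_) (lincomb-affineʳ (l ∘ suc) (d ∘ suc) (h ∘ suc) s) ⟩
  head +ℚ (D +ℚ s * H)
    ≡⟨ solve 6 (λ l₀ d₀ h₀ s D H →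
         l₀ :* (d₀ :+ s :* h₀) :+ (D :+ s :* H)
           := (l₀ :* d₀ :+ D) :+ s :* (l₀ :* h₀ :+ H))
         refl (l zero) (d zero) (h zero) s D H ⟩
  (l zero * d zero +ℚ D) +ℚ s * (l zero * h zero +ℚ H)  ∎
  where
  head = l zero * (d zero +ℚ s * h zero)
  D = lincomb (l ∘ suc) (d ∘ suc)
  H = lincomb (l ∘ suc) (h ∘ suc)

*-≢0 : ∀ {p q : ℚ} → p ≢ 0ℚ → q ≢ 0ℚ → p * q ≢ 0ℚ
*-≢0 {p} {q} p≢0 q≢0 pq≡0 = q≢0 (begin
  q                  ≡⟨ sym (*-identityˡ q) ⟩
  1ℚ * q             ≡⟨ cong (_* q) (sym (*-inverseˡ p)) ⟩
  (1/ p * p) * q     ≡⟨ *-assoc (1/ p) p q ⟩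
  1/ p * (p * q)     ≡⟨ cong (1/ p *_) pq≡0 ⟩
  1/ p * 0ℚ          ≡⟨ *-zeroʳ (1/ p) ⟩
  0ℚ                 ∎)
  where instance _ = ≢-nonZero p≢0

module _ {R C : Set} (M : Mat R C) where

  Annihilates : ∀ {k} → (Fin k → C) → (Fin k → ℚ) → Set
  Annihilates f l = ∀ x → lincomb l (λ j → M x (f j)) ≡ 0ℚ

  Dependent : ∀ {k} → (Fin k → C) → Set
  Dependent f = ∃ λ l → Annihilates f l × ∃ λ j → l j ≢ 0ℚ

  ¬indep⇒¬¬dependent : ∀ {k} (f : Fin k → C) → ¬ IndepCols M f → ¬ ¬ Dependent f
  ¬indep⇒¬¬dependent f ¬indep ¬dep = ¬indep λ l annihilates j →
    decidable-stable (l j ≟ 0ℚ) (λ lⱼ≢0 → ¬dep (l , annihilates , j , lⱼ≢0))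

  indep-stable : ∀ {k} (f : Fin k → C) → ¬ ¬ IndepCols M f → IndepCols M f
  indep-stable f ¬¬indep l annihilates j =
    decidable-stable (l j ≟ 0ℚ) λ lⱼ≢0 →
      ¬¬indep (λ indep → lⱼ≢0 (indep l annihilates j))

  indep-tail : ∀ {n} (g : Fin (suc n) → C) → IndepCols M g → IndepCols M (g ∘ suc)
  indep-tail g indep l annihilates j = indep (0ℚ ∷ l) annihilates′ (suc j)
    where
    annihilates′ : Annihilates g (0ℚ ∷ l)
    annihilates′ x = begin
      0ℚ * M x (g zero) +ℚ L  ≡⟨ cong (_+ℚ L) (*-zeroˡ (M x (g zero))) ⟩
      0ℚ +ℚ L                 ≡⟨ +-identityˡ L ⟩
      L                       ≡⟨ annihilates x ⟩
      0ℚ                      ∎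
      where L = lincomb l (M x ∘ g ∘ suc)

  indep-shrink : ∀ {m n} → n ≤ m → (g : Fin m → C) → IndepCols M g →
                 Σ (Fin n → C) (IndepCols M)
  indep-shrink {zero}  z≤n   g indep = g , indep
  indep-shrink {suc m} n≤1+m g indep with ℕ.m≤n⇒m<n∨m≡n n≤1+m
  ... | inj₁ n<1+m = indep-shrink (s≤s⁻¹ n<1+m) (g ∘ suc) (indep-tail g indep)
  ... | inj₂ refl  = g , indep

  indep⇒≤rank : ∀ {k m} → HasRank M k → Σ (Fin m → C) (IndepCols M) → m ≤ k
  indep⇒≤rank {k} {m} (_ , maximal) (g , indep) with m ≤? k
  ... | yes m≤k = m≤k
  ... | no  m≰k =
    let h , indep′ = indep-shrink (ℕ.≰⇒> m≰k) g indep in ⊥-elim (maximal h indep′)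

  rank-unique : ∀ {k k′} → HasRank M k → HasRank M k′ → k ≡ k′
  rank-unique H H′ =
    ℕ.≤-antisym (indep⇒≤rank H′ (proj₁ H)) (indep⇒≤rank H (proj₁ H′))

_≗ₘ_ : {R C : Set} → Mat R C → Mat R C → Set
M ≗ₘ M′ = ∀ x y → M x y ≡ M′ x y

module _ {R C : Set} {M M′ : Mat R C} (M≗M′ : M ≗ₘ M′) where

  indep-cong : ∀ {k} (f : Fin k → C) → IndepCols M f → IndepCols M′ f
  indep-cong f indep l annihilates =
    indep l (λ x → trans (lincomb-congʳ l (λ j → M≗M′ x (f j))) (annihilates x))

  rank-cong : ∀ {k} → HasRank M k → HasRank M′ k
  rank-cong ((f , indep) , maximal) =
    (f , indep-cong f indep) , λ g indep′ → maximal g (indep-cong′ g indep′)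
    where
    indep-cong′ : ∀ {n} (g : Fin n → C) → IndepCols M′ g → IndepCols M g
    indep-cong′ g indep′ l annihilates =
      indep′ l λ x →
        trans (lincomb-congʳ l (λ j → sym (M≗M′ x (g j)))) (annihilates x)

submatrix : {R C R′ C′ : Set} → Mat R C → (R′ → R) → (C′ → C) → Mat R′ C′
submatrix M ρ κ x y = M (ρ x) (κ y)

module _ {R C R′ C′ : Set} (M : Mat R C) (ρ : R′ → R) (κ : C′ → C) where

  indep-submatrix : ∀ {k} (f : Fin k → C′) →
                    IndepCols (submatrix M ρ κ) f → IndepCols M (κ ∘ f)
  indep-submatrix f indep l annihilates = indep l (annihilates ∘ ρ)

  rank-submatrix : ∀ {k} → HasRank M k → Σ (Fin k → C′) (IndepCols (submatrix M ρ κ)) →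
                   HasRank (submatrix M ρ κ) k
  rank-submatrix (_ , maximal) basis =
    basis , λ g indep → maximal (κ ∘ g) (indep-submatrix g indep)

record RankOneLine {R C : Set} (N : ℚ → Mat R C) : Set where
  field
    base : Mat R C
    ε    : R → ℚ
    η    : C → ℚ
    line : ∀ t x y → N t x y ≡ base x y +ℚ t * (ε x * η y)

submatrix-line : {R C R′ C′ : Set} {N : ℚ → Mat R C} → RankOneLine N →
                 (ρ : R′ → R) (κ : C′ → C) →
                 RankOneLine (λ t → submatrix (N t) ρ κ)
submatrix-line L ρ κ = record
  { base = submatrix base ρ κ
  ; ε    = ε ∘ ρ
  ; η    = η ∘ κ
  ; line = λ t x y → line t (ρ x) (κ y)
  }
  where open RankOneLine L

module _ {R C : Set} {N : ℚ → Mat R C} (L : RankOneLine N) {k : ℕ} (f : Fin k → C) where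
  open RankOneLine L

  weight : (Fin k → ℚ) → ℚ
  weight l = lincomb l (η ∘ f)

  lincomb-line : ∀ t l x →
    lincomb l (λ j → N t x (f j)) ≡ lincomb l (λ j → base x (f j)) +ℚ t * ε x * weight l
  lincomb-line t l x = trans (lincomb-congʳ l line′) (lincomb-affineʳ l _ _ (t * ε x))
    where
    line′ : ∀ j → N t x (f j) ≡ base x (f j) +ℚ t * ε x * η (f j)
    line′ j = trans (line t x (f j))
                    (cong (base x (f j) +ℚ_) (sym (*-assoc t (ε x) (η (f j)))))

  annihilates-shift : ∀ b t l → Annihilates (N b) f l →
    ∀ x → lincomb l (λ j → N t x (f j)) ≡ (t - b) * ε x * weight l
  annihilates-shift b t l annihilates x = begin
    lincomb l (λ j → N t x (f j))
      ≡⟨ lincomb-line t l x ⟩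
    B +ℚ t * ε x * W
      ≡⟨ solve 5 (λ B t b e W →
           B :+ t :* e :* W := (B :+ b :* e :* W) :+ (t :- b) :* e :* W)
           refl B t b (ε x) W ⟩
    (B +ℚ b * ε x * W) +ℚ (t - b) * ε x * W
      ≡⟨ cong (_+ℚ (t - b) * ε x * W) (trans (sym (lincomb-line b l x)) (annihilates x)) ⟩
    0ℚ +ℚ (t - b) * ε x * W
      ≡⟨ +-identityˡ _ ⟩
    (t - b) * ε x * W ∎
    where
    B = lincomb l (λ j → base x (f j))
    W = weight l

  weightless-annihilates : ∀ b t l → weight l ≡ 0ℚ →
                           Annihilates (N b) f l → Annihilates (N t) f l
  weightless-annihilates b t l W≡0 annihilates x = begin
    lincomb l (λ j → N t x (f j))  ≡⟨ annihilates-shift b t l annihilates x ⟩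
    (t - b) * ε x * weight l       ≡⟨ cong ((t - b) * ε x *_) W≡0 ⟩
    (t - b) * ε x * 0ℚ             ≡⟨ *-zeroʳ ((t - b) * ε x) ⟩
    0ℚ                             ∎

  -- The combination (t − b′)(η·m) l + (b − t)(η·l) m annihilates N t, so it vanishes
  -- when f is independent at t; its weight is (b − b′)(η·l)(η·m).
  indep⇒weights-degenerate : ∀ b b′ t l m →
                             Annihilates (N b) f l → Annihilates (N b′) f m →
                             IndepCols (N t) f → (b - b′) * (weight l * weight m) ≡ 0ℚ
  indep⇒weights-degenerate b b′ t l m annihilatesˡ annihilatesᵐ indep = begin
    (b - b′) * (weight l * weight m)
      ≡⟨ solve 5 (λ t b b′ Wl Wm →
           (b :- b′) :* (Wl :* Wm) := (t :- b′) :* Wm :* Wl :+ (b :- t) :* Wl :* Wm)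
           refl t b b′ (weight l) (weight m) ⟩
    α * weight l +ℚ β * weight m
      ≡⟨ sym (lincomb-linearˡ α β l m (η ∘ f)) ⟩
    weight ν
      ≡⟨ lincomb-zeroˡ (η ∘ f) (indep ν annihilatesⁿ) ⟩
    0ℚ ∎
    where
    α = (t - b′) * weight m
    β = (b - t) * weight l
    ν : Fin k → ℚ
    ν j = α * l j +ℚ β * m j
    annihilatesⁿ : Annihilates (N t) f ν
    annihilatesⁿ x = begin
      lincomb ν (λ j → N t x (f j))
        ≡⟨ lincomb-linearˡ α β l m _ ⟩
      α * lincomb l (λ j → N t x (f j)) +ℚ β * lincomb m (λ j → N t x (f j))
        ≡⟨ cong₂ (λ u v → α * u +ℚ β * v) (annihilates-shift b t l annihilatesˡ x)
                                          (annihilates-shift b′ t m annihilatesᵐ x) ⟩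
      α * ((t - b) * ε x * weight l) +ℚ β * ((t - b′) * ε x * weight m)
        ≡⟨ solve 6 (λ t b b′ e Wl Wm →
             (t :- b′) :* Wm :* ((t :- b) :* e :* Wl)
               :+ (b :- t) :* Wl :* ((t :- b′) :* e :* Wm)
               := con 0ℚ)
             refl t b b′ (ε x) (weight l) (weight m) ⟩
      0ℚ ∎

  dependent-twice⇒¬indep : ∀ b b′ t → b ≢ b′ →
                           Dependent (N b) f → Dependent (N b′) f → ¬ IndepCols (N t) f
  dependent-twice⇒¬indep b b′ t b≢b′
    (l , annihilatesˡ , i , lᵢ≢0) (m , annihilatesᵐ , j , mⱼ≢0) indep
    with weight l ≟ 0ℚ | weight m ≟ 0ℚ
  ... | yes Wl≡0 | _ =
    lᵢ≢0 (indep l (weightless-annihilates b t l Wl≡0 annihilatesˡ) i)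
  ... | no _ | yes Wm≡0 =
    mⱼ≢0 (indep m (weightless-annihilates b′ t m Wm≡0 annihilatesᵐ) j)
  ... | no Wl≢0 | no Wm≢0 =
    *-≢0 (b≢b′ ∘ x∙y⁻¹≈ε⇒x≈y _ _) (*-≢0 Wl≢0 Wm≢0)
         (indep⇒weights-degenerate b b′ t l m annihilatesˡ annihilatesᵐ indep)

  ¬indep-twice⇒¬indep : ∀ b b′ t → b ≢ b′ →
                        ¬ IndepCols (N b) f → ¬ IndepCols (N b′) f → ¬ IndepCols (N t) f
  ¬indep-twice⇒¬indep b b′ t b≢b′ ¬indep ¬indep′ indep =
    ¬indep⇒¬¬dependent (N b) f ¬indep λ dep →
    ¬indep⇒¬¬dependent (N b′) f ¬indep′ λ dep′ →
    dependent-twice⇒¬indep b b′ t b≢b′ dep dep′ indep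

module _ {R C R′ C′ : Set} {N : ℚ → Mat R C} (L : RankOneLine N)
         (ρ : R′ → R) (κ : C′ → C) where

  private
    N′ : ℚ → Mat R′ C′
    N′ t = submatrix (N t) ρ κ

  rank-submatrix-along-line : ∀ {a b t k} → HasRank (N a) k → HasRank (N b) k →
                              HasRank (N′ a) k → ¬ HasRank (N′ b) k → t ≢ b →
                              HasRank (N t) k × HasRank (N′ t) k
  rank-submatrix-along-line {a} {b} {t} {k} Hₐ Hᵇ ((f , indepₐ) , _) ¬H′ᵇ t≢b =
    Hₜ , rank-submatrix (N t) ρ κ Hₜ (f , indepₜ)
    where
    ¬indepᵇ : (g : Fin k → C′) → ¬ IndepCols (N′ b) g
    ¬indepᵇ g indep = ¬H′ᵇ (rank-submatrix (N b) ρ κ Hᵇ (g , indep))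

    a≢b : a ≢ b
    a≢b refl = ¬indepᵇ f indepₐ

    indepₜ : IndepCols (N′ t) f
    indepₜ = indep-stable (N′ t) f λ ¬indepₜ →
      ¬indep-twice⇒¬indep (submatrix-line L ρ κ) f t b a t≢b
                          ¬indepₜ (¬indepᵇ f) indepₐ

    Hₜ : HasRank (N t) k
    Hₜ = (κ ∘ f , indep-submatrix (N t) ρ κ f indepₜ) ,
         λ g → ¬indep-twice⇒¬indep L g a b t a≢b (proj₂ Hₐ g) (proj₂ Hᵇ g)

module _ {r c : ℕ} where

  Rows Cols : Fin r ⊎ Fin c → Set
  Rows (inj₁ i) = Σ (Fin r) (_≢ i)
  Rows (inj₂ _) = Fin r
  Cols (inj₁ _) = Fin c
  Cols (inj₂ i) = Σ (Fin c) (_≢ i)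

  rowOf : (u : Fin r ⊎ Fin c) → Rows u → Fin r
  rowOf (inj₁ _) = proj₁
  rowOf (inj₂ _) = id

  colOf : (u : Fin r ⊎ Fin c) → Cols u → Fin c
  colOf (inj₁ _) = id
  colOf (inj₂ _) = proj₁

  _∖_ : Mat (Fin r) (Fin c) → (u : Fin r ⊎ Fin c) → Mat (Rows u) (Cols u)
  M ∖ u = submatrix M (rowOf u) (colOf u)

  rankDel≡rank-∖ : (M : Mat (Fin r) (Fin c)) (u : Fin r ⊎ Fin c) (k : ℕ) →
                   rankDel M u k ≡ HasRank (M ∖ u) k
  rankDel≡rank-∖ M (inj₁ _) k = refl
  rankDel≡rank-∖ M (inj₂ _) k = refl

δ : ∀ {n} → Fin n → Fin n → ℚ
δ i j with j ≟ᶠ i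
... | yes _ = 1ℚ
... | no  _ = 0ℚ

evalSet-line : ∀ {r c} (A : MixedMatrix r c) (val : Fin r → Fin c → ℚ)
               {p : Fin r} {q : Fin c} →
               IsVar A (p , q) → RankOneLine (evalSet A val (p , q))
evalSet-line A val {p} {q} isVar = record
  { base = evalSet A val (p , q) 0ℚ ; ε = δ p ; η = δ q ; line = line }
  where
  unchanged : ∀ v t → v ≡ v +ℚ t * 0ℚ
  unchanged v t = sym (trans (cong (v +ℚ_) (*-zeroʳ t)) (+-identityʳ v))

  line : ∀ t x y → evalSet A val (p , q) t x y
                   ≡ evalSet A val (p , q) 0ℚ x y +ℚ t * (δ p x * δ q y)
  line t x y with A x y in Axy
  ... | nothing with x ≟ᶠ p | y ≟ᶠ q
  ...   | yes _    | yes _    = sym (trans (+-identityˡ _) (*-identityʳ t))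
  ...   | yes _    | no _     = unchanged (val x y) t
  ...   | no _     | yes _    = unchanged (val x y) t
  ...   | no _     | no _     = unchanged (val x y) t
  line t x y | just v with x ≟ᶠ p | y ≟ᶠ q
  ...   | yes refl | yes refl with () ← trans (sym Axy) isVar
  ...   | yes _    | no _     = unchanged v t
  ...   | no _     | yes _    = unchanged v t
  ...   | no _     | no _     = unchanged v t

eval≗evalSet-current : ∀ {r c} (A : MixedMatrix r c) (val : Fin r → Fin c → ℚ)
                       (p : Fin r) (q : Fin c) →
                       eval A val ≗ₘ evalSet A val (p , q) (val p q)
eval≗evalSet-current A val p q x y with A x y
... | just _  = refl
... | nothing with x ≟ᶠ p | y ≟ᶠ q
...   | yes refl | yes refl = refl
...   | yes _    | no _     = refl
...   | no _     | _        = refl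

lemma5p4 : {r c : ℕ} (A : MixedMatrix r c) (val : Fin r → Fin c → ℚ)
    (p : Fin r) (q : Fin c) → IsVar A (p , q) →
    (a : ℕ) → 1 ≤ a → a ≤ (r + c) ^ 10 →
    (k : ℕ) → HasRank (evalSet A val (p , q) (ℕtoℚ a)) k → HasRank (eval A val) k →
    (u : Fin r ⊎ Fin c) → InD u (evalSet A val (p , q) (ℕtoℚ a)) → ¬ InD u (eval A val) →
    (ã : ℚ) → ã ≢ val p q → InD u (evalSet A val (p , q) ã)
lemma5p4 A val p q isVar a _ _ k Hₐ H u (k′ , Hₐ′ , Delₐ) u∉D ã ã≢val =
  k , proj₁ rankₜ , subst id (sym (rankDel≡rank-∖ (N ã) u k)) (proj₂ rankₜ)
  where
  N : ℚ → Mat (Fin _) (Fin _)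
  N = evalSet A val (p , q)

  Delₐ′ : HasRank (N (ℕtoℚ a) ∖ u) k
  Delₐ′ = subst (HasRank (N (ℕtoℚ a) ∖ u)) (rank-unique (N (ℕtoℚ a)) Hₐ′ Hₐ)
            (subst id (rankDel≡rank-∖ (N (ℕtoℚ a)) u k′) Delₐ)

  N≗ : eval A val ≗ₘ N (val p q)
  N≗ = eval≗evalSet-current A val p q

  ¬Del : ¬ HasRank (N (val p q) ∖ u) k
  ¬Del Del = u∉D (k , H , subst id (sym (rankDel≡rank-∖ (eval A val) u k))
                   (rank-cong (λ x y → sym (N≗ (rowOf u x) (colOf u y))) Del))

  rankₜ : HasRank (N ã) k × HasRank (N ã ∖ u) k
  rankₜ = rank-submatrix-along-line (evalSet-line A val isVar) (rowOf u) (colOf u)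
            Hₐ (rank-cong N≗ H) Delₐ′ ¬Del ã≢val
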